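{- Let $C$ be a ternary self-dual code of length $n\equiv 0\pmod{12}$ with $\mathbf{1}\in C$, where $\mathbf{1}$ is the all-ones vector. Let $v=(v_1,\dots,v_n)$ be a codeword of weight $n$ in $C$, and let $P$ be the $n\times n$ diagonal matrix whose diagonal entries are $v_1,\dots,v_n$ regarded as elements of $\{\pm1\}\subset\mathbb{Z}$ (so $C\cdot P$ denotes the image of $C$ under the corresponding monomial matrix over $\mathbb{F}_3$). Then $L_S(C)\cdot P=L_S(C\cdot P)$ if $\prod_{i=1}^n v_i=1$, and $L_S(C)\cdot P=L_T(C\cdot P)$ otherwise.
   Context: For a ternary self-dual code $D$ of length $n$ (i.e. $D=D^\perp\subseteq\mathbb{F}_3^n$), let $A_3(D)=\frac{1}{\sqrt3}\{x\in\mathbb{Z}^n : x\bmod 3\in D\}$ and $B_3(D)=\{u\in A_3(D) : (u,u)\in2\mathbb{Z}\}$. If $\mathbf{1}\in D$ and $n\equiv0\pmod{12}$, define $L_S(D)=\langle \frac{1}{2\sqrt3}\mathbf{1}, B_3(D)\rangle$ and $L_T(D)=\langle \frac{1}{2\sqrt3}\mathbf{1}-e_1, B_3(D)\rangle$ (lattices generated by the given vectors), where $e_1=(\sqrt3,0,\dots,0)$ and $\mathbf{1}$ is also regarded as the all-ones vector in $\mathbb{Z}^n$. Elements of $\mathbb{F}_3$ are identified with $\{0,1,-1\}$. -}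

module Defs where

open import Data.Nat as ℕ using (ℕ; zero; suc)
open import Data.Integer as ℤ using (ℤ; +_; -_; _+_; _-_; _*_)
open import Data.Integer.Divisibility using () renaming (_∣_ to _∣ℤ_)
open import Data.Fin using (Fin; zero; suc)
open import Data.Vec using (Vec; []; _∷_; map; zipWith; replicate; lookup)
open import Data.Product using (Σ; ∃; _×_; _,_)
open import Data.Sum using (_⊎_)
open import Relation.Binary.PropositionalEquality using (_≡_; _≢_)

-- The field F_3, elements identified with {0, 1, -1}

F3 : Set
F3 = Fin 3

ι : F3 → ℤ
ι zero             = + 0
ι (suc zero)       = + 1
ι (suc (suc zero)) = - (+ 1)

_·₃_ : F3 → F3 → F3
zero ·₃ b = zero
suc zero ·₃ b = b
suc (suc zero) ·₃ zero = zero
suc (suc zero) ·₃ suc zero = suc (suc zero)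
suc (suc zero) ·₃ suc (suc zero) = suc zero

one₃ : F3
one₃ = suc zero

sumℤ : ∀ {n} → Vec ℤ n → ℤ
sumℤ []       = + 0
sumℤ (x ∷ xs) = x + sumℤ xs

prodℤ : ∀ {n} → Vec ℤ n → ℤ
prodℤ []       = + 1
prodℤ (x ∷ xs) = x * prodℤ xs

Code : ℕ → Set₁
Code n = Vec F3 n → Set

dotℤ : ∀ {n} → Vec F3 n → Vec F3 n → ℤ
dotℤ x y = sumℤ (zipWith _*_ (map ι x) (map ι y))

Dual : ∀ {n} → Code n → Code n
Dual D x = ∀ y → D y → (+ 3) ∣ℤ dotℤ x y

SelfDual : ∀ {n} → Code n → Set
SelfDual D = ∀ x → (D x → Dual D x) × (Dual D x → D x)

𝟏 : ∀ n → Vec F3 n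
𝟏 n = replicate n one₃

FullWeight : ∀ {n} → Vec F3 n → Set
FullWeight v = ∀ i → lookup v i ≢ zero

_·ᶜ_ : ∀ {n} → Code n → Vec F3 n → Code n
(C ·ᶜ v) w = ∃ λ c → C c × (w ≡ zipWith _·₃_ c v)

-- Lattices.  A vector y ∈ ℤ^n represents the real vector y / (2√3).
-- All lattices considered lie in (1/(2√3)) ℤ^n, so this is exact.

Mod3In : ∀ {n} → Code n → Vec ℤ n → Set
Mod3In {n} D x = ∃ λ c → D c × (∀ (i : Fin n) → (+ 3) ∣ℤ (lookup x i - ι (lookup c i)))

-- A_3(D) = (1/√3){x : x mod 3 ∈ D}; x/√3 is represented by 2x
A3 : ∀ {n} → Code n → Vec ℤ n → Set
A3 D y = ∃ λ x → Mod3In D x × (y ≡ map (λ t → + 2 * t) x)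

-- B_3(D) = {u ∈ A_3(D) : (u,u) ∈ 2ℤ}; for u = x/√3, (u,u) = (Σ x_i²)/3
B3 : ∀ {n} → Code n → Vec ℤ n → Set
B3 D y = ∃ λ x → Mod3In D x
                × (∃ λ (k : ℤ) → sumℤ (zipWith _*_ x x) ≡ + 3 * (+ 2 * k))
                × (y ≡ map (λ t → + 2 * t) x)

data Span {n} (G : Vec ℤ n → Set) : Vec ℤ n → Set where
  gen : ∀ {x} → G x → Span G x
  zer : Span G (replicate n (+ 0))
  add : ∀ {x y} → Span G x → Span G y → Span G (zipWith _+_ x y)
  neg : ∀ {x} → Span G x → Span G (map -_ x)

-- (1/(2√3)) 𝟏  is represented by the all-ones integer vector
onesℤ : ∀ n → Vec ℤ n
onesℤ n = replicate n (+ 1)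

-- e_1 = (√3,0,…,0) = (1/(2√3))·(6,0,…,0)
e₁ : ∀ n → Vec ℤ n
e₁ zero    = []
e₁ (suc n) = + 6 ∷ replicate n (+ 0)

LS : ∀ {n} → Code n → Vec ℤ n → Set
LS {n} D = Span (λ y → (y ≡ onesℤ n) ⊎ B3 D y)

LT : ∀ {n} → Code n → Vec ℤ n → Set
LT {n} D = Span (λ y → (y ≡ zipWith _-_ (onesℤ n) (e₁ n)) ⊎ B3 D y)

_·ᴸ_ : ∀ {n} → (Vec ℤ n → Set) → Vec F3 n → Vec ℤ n → Set
(L ·ᴸ v) y = ∃ λ z → L z × (y ≡ zipWith _*_ z (map ι v))

SameLattice : ∀ {n} → (Vec ℤ n → Set) → (Vec ℤ n → Set) → Set
SameLattice L M = ∀ y → (L y → M y) × (M y → L y)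

module Submission where

open import Defs
open import Data.Nat using (ℕ)
open import Data.Nat.Divisibility using (_∣_)
open import Data.Integer using (+_)
open import Data.Vec using (Vec; map)
open import Data.Product using (_×_)
open import Relation.Binary.PropositionalEquality using (_≡_; _≢_)

import Data.Nat as N
import Data.Nat.Divisibility as ND
open import Data.Nat.LCM using (lcm-least)
open import Data.Integer using (ℤ; -_; _+_; _-_; _*_)
import Data.Integer.Properties as ZP
import Data.Integer.Divisibility as U
import Data.Integer.Divisibility.Signed as S
open import Data.Integer.Tactic.RingSolver using (solve-∀)
open import Data.Fin using (zero; suc)
open import Data.Vec using ([]; _∷_; zipWith; replicate; lookup)
open import Data.Vec.Properties using (lookup-map; lookup-zipWith; ∷-injectiveˡ; ∷-injectiveʳ)
open import Data.Product using (∃-syntax; _,_; proj₁; proj₂)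
open import Data.Sum using (_⊎_; inj₁; inj₂)
open import Data.Empty using (⊥-elim)
open import Relation.Binary.PropositionalEquality using (refl; sym; trans; cong; cong₂; subst; module ≡-Reasoning)

-- Write s = (ι v₁,…,ι vₙ) ∈ {±1}ⁿ for the signs of v; multiplication by
-- s is an involution of ℤⁿ, and it maps B₃(C) onto B₃(C·P) because it preserves
-- norms and reductions mod 3.  Hence L_S(C)·P and a lattice ⟨t, B₃(C·P)⟩ coincide as
-- soon as t·P = 𝟏 + b for some b ∈ B₃(C) (then also 𝟏·P = t − b·P).  To find b, let
-- δ = ι(𝟏 − v) ∈ {0,−1}ⁿ; since C is self-dual, 𝟏 − v ∈ C, so 3 divides the number m
-- of entries −1 of v, whose parity is given by ∏ vᵢ.  If ∏ vᵢ = 1 then 6 ∣ m,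
-- 2δ ∈ B₃(C) and s = 𝟏 + 2δ, giving L_S(C·P) (t = 𝟏).  If ∏ vᵢ = −1 then m ≡ 3 mod 6;
-- changing the first entry of δ by −3ι(v₁) gives δ' with 2δ' ∈ B₃(C) and
-- (𝟏 − e₁)·P = 𝟏 + 2δ', giving L_T(C·P) (t = 𝟏 − e₁).

_-₃_ : F3 → F3 → F3
zero -₃ zero = zero
zero -₃ suc zero = suc (suc zero)
zero -₃ suc (suc zero) = suc zero
suc zero -₃ zero = suc zero
suc zero -₃ suc zero = zero
suc zero -₃ suc (suc zero) = suc (suc zero)
suc (suc zero) -₃ zero = suc (suc zero)
suc (suc zero) -₃ suc zero = suc zero
suc (suc zero) -₃ suc (suc zero) = zero

ι-sub : ∀ a b → ∃[ k ] ι (a -₃ b) ≡ ι a - ι b + + 3 * k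
ι-sub zero zero = + 0 , refl
ι-sub zero (suc zero) = + 0 , refl
ι-sub zero (suc (suc zero)) = + 0 , refl
ι-sub (suc zero) zero = + 0 , refl
ι-sub (suc zero) (suc zero) = + 0 , refl
ι-sub (suc zero) (suc (suc zero)) = - + 1 , refl
ι-sub (suc (suc zero)) zero = + 0 , refl
ι-sub (suc (suc zero)) (suc zero) = + 1 , refl
ι-sub (suc (suc zero)) (suc (suc zero)) = + 0 , refl

ι-mul : ∀ a b → ι (a ·₃ b) ≡ ι a * ι b
ι-mul zero zero = refl
ι-mul zero (suc zero) = refl
ι-mul zero (suc (suc zero)) = refl
ι-mul (suc zero) zero = refl
ι-mul (suc zero) (suc zero) = refl
ι-mul (suc zero) (suc (suc zero)) = refl
ι-mul (suc (suc zero)) zero = refl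
ι-mul (suc (suc zero)) (suc zero) = refl
ι-mul (suc (suc zero)) (suc (suc zero)) = refl

ι-square : ∀ a → a ≢ zero → ι a * ι a ≡ + 1
ι-square zero a≢0 = ⊥-elim (a≢0 refl)
ι-square (suc zero) _ = refl
ι-square (suc (suc zero)) _ = refl

·₃-cancel : ∀ c a → a ≢ zero → (c ·₃ a) ·₃ a ≡ c
·₃-cancel c zero a≢0 = ⊥-elim (a≢0 refl)
·₃-cancel zero (suc zero) _ = refl
·₃-cancel (suc zero) (suc zero) _ = refl
·₃-cancel (suc (suc zero)) (suc zero) _ = refl
·₃-cancel zero (suc (suc zero)) _ = refl
·₃-cancel (suc zero) (suc (suc zero)) _ = refl
·₃-cancel (suc (suc zero)) (suc (suc zero)) _ = refl

sign-from-defect : ∀ a → a ≢ zero → ι a ≡ + 1 + + 2 * ι (one₃ -₃ a)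
sign-from-defect zero a≢0 = ⊥-elim (a≢0 refl)
sign-from-defect (suc zero) _ = refl
sign-from-defect (suc (suc zero)) _ = refl

-- The same with the defect shifted by −3a; this is the first coordinate of (𝟏 − e₁)·P.
sign-from-shifted-defect : ∀ a → a ≢ zero →
  (+ 1 - + 6) * ι a ≡ + 1 + + 2 * (ι (one₃ -₃ a) - + 3 * ι a)
sign-from-shifted-defect zero a≢0 = ⊥-elim (a≢0 refl)
sign-from-shifted-defect (suc zero) _ = refl
sign-from-shifted-defect (suc (suc zero)) _ = refl

infixl 7 _⊙_
infixl 6 _⊕_

_⊙_ : ∀ {n} → Vec ℤ n → Vec ℤ n → Vec ℤ n
_⊙_ = zipWith _*_

_⊕_ : ∀ {n} → Vec ℤ n → Vec ℤ n → Vec ℤ n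
_⊕_ = zipWith _+_

signs : ∀ {n} → Vec F3 n → Vec ℤ n
signs = map ι

double : ∀ {n} → Vec ℤ n → Vec ℤ n
double = map (λ t → + 2 * t)

norm : ∀ {n} → Vec ℤ n → ℤ
norm x = sumℤ (zipWith _*_ x x)

tail-full : ∀ {n} {a : F3} {v : Vec F3 n} → FullWeight (a ∷ v) → FullWeight v
tail-full fw i = fw (suc i)

⊙-zeroˡ : ∀ {n} (s : Vec ℤ n) → replicate n (+ 0) ⊙ s ≡ replicate n (+ 0)
⊙-zeroˡ [] = refl
⊙-zeroˡ (_ ∷ s) = cong (+ 0 ∷_) (⊙-zeroˡ s)

⊙-identityˡ : ∀ {n} (s : Vec ℤ n) → onesℤ n ⊙ s ≡ s
⊙-identityˡ [] = refl
⊙-identityˡ (c ∷ s) = cong₂ _∷_ (ZP.*-identityˡ c) (⊙-identityˡ s)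

⊙-distribʳ-⊕ : ∀ {n} (x y s : Vec ℤ n) → (x ⊕ y) ⊙ s ≡ x ⊙ s ⊕ y ⊙ s
⊙-distribʳ-⊕ [] [] [] = refl
⊙-distribʳ-⊕ (a ∷ x) (b ∷ y) (c ∷ s) = cong₂ _∷_ (ZP.*-distribʳ-+ c a b) (⊙-distribʳ-⊕ x y s)

⊙-negˡ : ∀ {n} (x s : Vec ℤ n) → map -_ x ⊙ s ≡ map -_ (x ⊙ s)
⊙-negˡ [] [] = refl
⊙-negˡ (a ∷ x) (c ∷ s) = cong₂ _∷_ (sym (ZP.neg-distribˡ-* a c)) (⊙-negˡ x s)

double-⊙ : ∀ {n} (x s : Vec ℤ n) → double x ⊙ s ≡ double (x ⊙ s)
double-⊙ [] [] = refl
double-⊙ (a ∷ x) (c ∷ s) = cong₂ _∷_ (ZP.*-assoc (+ 2) a c) (double-⊙ x s)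

⊙-signs-involutive : ∀ {n} (y : Vec ℤ n) (v : Vec F3 n) → FullWeight v → y ⊙ signs v ⊙ signs v ≡ y
⊙-signs-involutive [] [] _ = refl
⊙-signs-involutive (b ∷ y) (a ∷ v) fw = cong₂ _∷_ head (⊙-signs-involutive y v (tail-full fw))
  where
  open ≡-Reasoning
  head : b * ι a * ι a ≡ b
  head = begin
    b * ι a * ι a   ≡⟨ ZP.*-assoc b (ι a) (ι a) ⟩
    b * (ι a * ι a) ≡⟨ cong (b *_) (ι-square a (fw zero)) ⟩
    b * + 1         ≡⟨ ZP.*-identityʳ b ⟩
    b               ∎

norm-⊙-signs : ∀ {n} (x : Vec ℤ n) (v : Vec F3 n) → FullWeight v → norm (x ⊙ signs v) ≡ norm x
norm-⊙-signs [] [] _ = refl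
norm-⊙-signs (b ∷ x) (a ∷ v) fw = cong₂ _+_ head (norm-⊙-signs x v (tail-full fw))
  where
  open ≡-Reasoning
  regroup : ∀ X S → (X * S) * (X * S) ≡ X * X * (S * S)
  regroup = solve-∀
  head : (b * ι a) * (b * ι a) ≡ b * b
  head = begin
    (b * ι a) * (b * ι a) ≡⟨ regroup b (ι a) ⟩
    b * b * (ι a * ι a)   ≡⟨ cong (b * b *_) (ι-square a (fw zero)) ⟩
    b * b * + 1           ≡⟨ ZP.*-identityʳ (b * b) ⟩
    b * b                 ∎

solve-for-signs : ∀ {n} (t b : Vec ℤ n) (v : Vec F3 n) → FullWeight v →
  t ⊙ signs v ≡ onesℤ n ⊕ b → onesℤ n ⊙ signs v ≡ t ⊕ map -_ (b ⊙ signs v)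
solve-for-signs [] [] [] _ _ = refl
solve-for-signs (τ ∷ t) (β ∷ b) (a ∷ v) fw eq =
  cong₂ _∷_ head (solve-for-signs t b v (tail-full fw) (∷-injectiveʳ eq))
  where
  open ≡-Reasoning
  σ = ι a
  expand : ∀ B S → + 1 * S ≡ (+ 1 + B) * S + - (B * S)
  expand = solve-∀
  τ≡ : τ ≡ (+ 1 + β) * σ
  τ≡ = begin
    τ             ≡⟨ sym (ZP.*-identityʳ τ) ⟩
    τ * + 1       ≡⟨ cong (τ *_) (sym (ι-square a (fw zero))) ⟩
    τ * (σ * σ)   ≡⟨ sym (ZP.*-assoc τ σ σ) ⟩
    τ * σ * σ     ≡⟨ cong (_* σ) (∷-injectiveˡ eq) ⟩
    (+ 1 + β) * σ ∎
  head : + 1 * σ ≡ τ + - (β * σ)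
  head = trans (expand β σ) (cong (λ z → z + - (β * σ)) (sym τ≡))

infixl 6 _⊖_

_⊖_ : ∀ {n} → Vec F3 n → Vec F3 n → Vec F3 n
_⊖_ = zipWith _-₃_

dot-sub : ∀ {n} (x y z : Vec F3 n) → ∃[ k ] dotℤ (x ⊖ y) z ≡ dotℤ x z - dotℤ y z + + 3 * k
dot-sub [] [] [] = + 0 , refl
dot-sub (a ∷ x) (b ∷ y) (c ∷ z) with ι-sub a b | dot-sub x y z
... | j , ιa-b | k , rest = j * ι c + k , (begin
    ι (a -₃ b) * ι c + dotℤ (x ⊖ y) z
      ≡⟨ cong₂ (λ p q → p * ι c + q) ιa-b rest ⟩
    (ι a - ι b + + 3 * j) * ι c + (dotℤ x z - dotℤ y z + + 3 * k)
      ≡⟨ regroup (ι a) (ι b) (ι c) j (dotℤ x z) (dotℤ y z) k ⟩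
    (ι a * ι c + dotℤ x z) - (ι b * ι c + dotℤ y z) + + 3 * (j * ι c + k) ∎)
  where
  open ≡-Reasoning
  regroup : ∀ A B G J X Y K → (A - B + + 3 * J) * G + (X - Y + + 3 * K)
                             ≡ (A * G + X) - (B * G + Y) + + 3 * (J * G + K)
  regroup = solve-∀

selfDual-sub : ∀ {n} (C : Code n) → SelfDual C → ∀ {x y} → C x → C y → C (x ⊖ y)
selfDual-sub C sd {x} {y} cx cy = proj₂ (sd (x ⊖ y)) λ z cz →
  let (k , eq) = dot-sub x y z
      3∣x = S.∣ᵤ⇒∣ {+ 3} {dotℤ x z} (proj₁ (sd x) cx z cz)
      3∣y = S.∣ᵤ⇒∣ {+ 3} {dotℤ y z} (proj₁ (sd y) cy z cz)
  in S.∣⇒∣ᵤ (subst (S._∣_ (+ 3)) (sym eq)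
       (S.∣m∣n⇒∣m+n (S.∣m∣n⇒∣m-n 3∣x 3∣y) (S.∣m⇒∣m*n k S.∣-refl)))

twist-twist-⊆ : ∀ {n} (C : Code n) (v : Vec F3 n) → FullWeight v → ∀ {c} → ((C ·ᶜ v) ·ᶜ v) c → C c
twist-twist-⊆ C v fw (_ , (c , cc , refl) , refl) = subst C (sym (cancel c v fw)) cc
  where
  cancel : ∀ {n} (c v : Vec F3 n) → FullWeight v → zipWith _·₃_ (zipWith _·₃_ c v) v ≡ c
  cancel [] [] _ = refl
  cancel (d ∷ c) (a ∷ v) fw = cong₂ _∷_ (·₃-cancel d a (fw zero)) (cancel c v (tail-full fw))

congruent-twist : ∀ x c a → U._∣_ (+ 3) (x - ι c) → U._∣_ (+ 3) (x * ι a - ι (c ·₃ a))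
congruent-twist x c a 3∣ rewrite ι-mul c a =
  S.∣⇒∣ᵤ (subst (S._∣_ (+ 3)) (distrib x (ι c) (ι a)) (S.∣m⇒∣m*n (ι a) (S.∣ᵤ⇒∣ {+ 3} {x - ι c} 3∣)))
  where
  distrib : ∀ X Y A → (X - Y) * A ≡ X * A - Y * A
  distrib = solve-∀

Mod3In-twist : ∀ {n} (C : Code n) (v : Vec F3 n) x → Mod3In C x → Mod3In (C ·ᶜ v) (x ⊙ signs v)
Mod3In-twist C v x (c , cc , 3∣) = zipWith _·₃_ c v , (c , cc , refl) , 3∣'
  where
  3∣' : ∀ i → U._∣_ (+ 3) (lookup (x ⊙ signs v) i - ι (lookup (zipWith _·₃_ c v) i))
  3∣' i rewrite lookup-zipWith _*_ i x (signs v) | lookup-map i ι v | lookup-zipWith _·₃_ i c v =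
    congruent-twist (lookup x i) (lookup c i) (lookup v i) (3∣ i)

Mod3In-mono : ∀ {n} {C D : Code n} → (∀ {c} → C c → D c) → ∀ x → Mod3In C x → Mod3In D x
Mod3In-mono C⊆D _ (c , cc , 3∣) = c , C⊆D cc , 3∣

B3-mono : ∀ {n} {C D : Code n} → (∀ {c} → C c → D c) → ∀ {y} → B3 C y → B3 D y
B3-mono C⊆D (x , mod3 , even , y≡) = x , Mod3In-mono C⊆D x mod3 , even , y≡

B3-twist : ∀ {n} (C : Code n) (v : Vec F3 n) → FullWeight v → ∀ {y} → B3 C y → B3 (C ·ᶜ v) (y ⊙ signs v)
B3-twist C v fw (x , mod3 , (k , nrm) , refl) =
  x ⊙ signs v , Mod3In-twist C v x mod3 , (k , trans (norm-⊙-signs x v fw) nrm) , double-⊙ x (signs v)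

B3-untwist : ∀ {n} (C : Code n) (v : Vec F3 n) → FullWeight v → ∀ {y} → B3 (C ·ᶜ v) y → B3 C (y ⊙ signs v)
B3-untwist C v fw b = B3-mono (twist-twist-⊆ C v fw) (B3-twist (C ·ᶜ v) v fw b)

span-⊙ : ∀ {n} {G G' : Vec ℤ n → Set} (s : Vec ℤ n) →
  (∀ {x} → G x → Span G' (x ⊙ s)) → ∀ {z} → Span G z → Span G' (z ⊙ s)
span-⊙ s gens (gen g) = gens g
span-⊙ {G' = G'} s gens zer = subst (Span G') (sym (⊙-zeroˡ s)) zer
span-⊙ {G' = G'} s gens (add {x} {y} p q) =
  subst (Span G') (sym (⊙-distribʳ-⊕ x y s)) (add (span-⊙ s gens p) (span-⊙ s gens q))
span-⊙ {G' = G'} s gens (neg {x} p) = subst (Span G') (sym (⊙-negˡ x s)) (neg (span-⊙ s gens p))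

-- Since the sign twist is an involution, two lattices correspond under it as soon
-- as the generators of each are mapped into the other.
twisted-span : ∀ {n} {G G' : Vec ℤ n → Set} (v : Vec F3 n) → FullWeight v →
  (∀ {x} → G x → Span G' (x ⊙ signs v)) → (∀ {x} → G' x → Span G (x ⊙ signs v)) →
  SameLattice ((Span G) ·ᴸ v) (Span G')
twisted-span v fw to from y =
  (λ { (z , z∈ , refl) → span-⊙ (signs v) to z∈ }) ,
  (λ y∈ → y ⊙ signs v , span-⊙ (signs v) from y∈ , sym (⊙-signs-involutive y v fw))

twisted-lattice : ∀ {n} (C : Code n) (v : Vec F3 n) → FullWeight v → (t b : Vec ℤ n) →
  B3 C b → t ⊙ signs v ≡ onesℤ n ⊕ b →
  SameLattice (LS C ·ᴸ v) (Span (λ y → (y ≡ t) ⊎ B3 (C ·ᶜ v) y))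
twisted-lattice {n} C v fw t b b∈ t·P≡ = twisted-span v fw to from
  where
  to : ∀ {x} → (x ≡ onesℤ n) ⊎ B3 C x → Span (λ y → (y ≡ t) ⊎ B3 (C ·ᶜ v) y) (x ⊙ signs v)
  to (inj₁ refl) = subst (Span _) (sym (solve-for-signs t b v fw t·P≡))
                     (add (gen (inj₁ refl)) (neg (gen (inj₂ (B3-twist C v fw b∈)))))
  to (inj₂ x∈) = gen (inj₂ (B3-twist C v fw x∈))
  from : ∀ {x} → (x ≡ t) ⊎ B3 (C ·ᶜ v) x → Span (λ y → (y ≡ onesℤ n) ⊎ B3 C y) (x ⊙ signs v)
  from (inj₁ refl) = subst (Span _) (sym t·P≡) (add (gen (inj₁ refl)) (gen (inj₂ b∈)))
  from (inj₂ x∈) = gen (inj₂ (B3-untwist C v fw x∈))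

defect : ∀ {n} → Vec F3 n → Vec ℤ n
defect {n} v = map ι (𝟏 n ⊖ v)

signs-from-defect : ∀ {n} (v : Vec F3 n) → FullWeight v → signs v ≡ onesℤ n ⊕ double (defect v)
signs-from-defect [] _ = refl
signs-from-defect (a ∷ v) fw = cong₂ _∷_ (sign-from-defect a (fw zero)) (signs-from-defect v (tail-full fw))

-- The norm of δ counts the entries −1 of v, so its parity is that of ∏ vᵢ.
defect-parity : ∀ {n} (v : Vec F3 n) → FullWeight v → ∃[ m ] norm (defect v) ≡ + m ×
  ((prodℤ (signs v) ≡ + 1 × 2 ∣ m) ⊎ (prodℤ (signs v) ≡ - + 1 × 2 ∣ N.suc m))
defect-parity [] _ = 0 , refl , inj₁ (refl , 2 ND.∣0)
defect-parity (a ∷ v) fw = step a (fw zero) (defect-parity v (tail-full fw))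
  where
  step : ∀ a → a ≢ zero → ∃[ m ] norm (defect v) ≡ + m ×
           ((prodℤ (signs v) ≡ + 1 × 2 ∣ m) ⊎ (prodℤ (signs v) ≡ - + 1 × 2 ∣ N.suc m)) →
         ∃[ m ] norm (defect (a ∷ v)) ≡ + m ×
           ((prodℤ (signs (a ∷ v)) ≡ + 1 × 2 ∣ m) ⊎ (prodℤ (signs (a ∷ v)) ≡ - + 1 × 2 ∣ N.suc m))
  step zero a≢0 _ = ⊥-elim (a≢0 refl)
  step (suc zero) _ (m , N≡m , inj₁ (∏≡ , 2∣)) =
    m , trans (ZP.+-identityˡ _) N≡m , inj₁ (cong ((+ 1) *_) ∏≡ , 2∣)
  step (suc zero) _ (m , N≡m , inj₂ (∏≡ , 2∣)) =
    m , trans (ZP.+-identityˡ _) N≡m , inj₂ (cong ((+ 1) *_) ∏≡ , 2∣)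
  step (suc (suc zero)) _ (m , N≡m , inj₁ (∏≡ , 2∣)) =
    N.suc m , cong (λ N → + 1 + N) N≡m , inj₂ (cong ((- + 1) *_) ∏≡ , ND.∣m∣n⇒∣m+n (ND.∣-refl {2}) 2∣)
  step (suc (suc zero)) _ (m , N≡m , inj₂ (∏≡ , 2∣)) =
    N.suc m , cong (λ N → + 1 + N) N≡m , inj₁ (cong ((- + 1) *_) ∏≡ , 2∣)

-- Self-orthogonality of 𝟏 − v ∈ C: the number of entries −1 of v is divisible by 3.
defect-norm-divisible : ∀ {n} (C : Code n) → SelfDual C → C (𝟏 n) → ∀ {v m} → C v →
  norm (defect v) ≡ + m → 3 ∣ m
defect-norm-divisible {n} C sd c1 {v} cv N≡m =
  subst (U._∣_ (+ 3)) N≡m (proj₁ (sd (𝟏 n ⊖ v)) u∈C (𝟏 n ⊖ v) u∈C)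
  where
  u∈C : C (𝟏 n ⊖ v)
  u∈C = selfDual-sub C sd c1 cv

six-∣-even : ∀ {m} → 2 ∣ m → 3 ∣ m → 6 ∣ m
six-∣-even = lcm-least

six-∣-odd : ∀ {m} → 2 ∣ N.suc m → 3 ∣ m → 6 ∣ 3 N.+ m
six-∣-odd 2∣ 3∣ = lcm-least (ND.∣m∣n⇒∣m+n (ND.∣-refl {2}) 2∣) (ND.∣m∣n⇒∣m+n (ND.∣-refl {3}) 3∣)

B3-intro : ∀ {n} (C : Code n) (x : Vec ℤ n) {m} → Mod3In C x → norm x ≡ + m → 6 ∣ m → B3 C (double x)
B3-intro C x {m} mod3 N≡m (ND.divides q m≡q*6) = x , mod3 , (+ q , norm≡) , refl
  where
  open ≡-Reasoning
  rearrange : ∀ Q → Q * + 6 ≡ + 3 * (+ 2 * Q)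
  rearrange = solve-∀
  norm≡ : norm x ≡ + 3 * (+ 2 * + q)
  norm≡ = begin
    norm x          ≡⟨ N≡m ⟩
    + m             ≡⟨ cong +_ m≡q*6 ⟩
    + (q N.* 6)     ≡⟨ ZP.pos-* q 6 ⟩
    + q * + 6       ≡⟨ rearrange (+ q) ⟩
    + 3 * (+ 2 * + q) ∎

Mod3In-lift : ∀ {n} (C : Code n) {c} → C c → Mod3In C (map ι c)
Mod3In-lift C {c} cc = c , cc , λ i → subst (λ z → U._∣_ (+ 3) (z - ι (lookup c i)))
  (sym (lookup-map i ι c)) (subst (U._∣_ (+ 3)) (sym (ZP.+-inverseʳ (ι (lookup c i)))) (3 ND.∣0))

Mod3In-shift-head : ∀ {n} (C : Code (N.suc n)) x xs k → Mod3In C (x ∷ xs) → Mod3In C ((x - + 3 * k) ∷ xs)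
Mod3In-shift-head C x xs k (c , cc , 3∣) = c , cc , 3∣'
  where
  shift : ∀ X Y K → (X - + 3 * K) - Y ≡ (X - Y) + (- K) * + 3
  shift = solve-∀
  3∣' : ∀ i → U._∣_ (+ 3) (lookup ((x - + 3 * k) ∷ xs) i - ι (lookup c i))
  3∣' zero = S.∣⇒∣ᵤ (subst (S._∣_ (+ 3)) (sym (shift x (ι (lookup c zero)) k))
    (S.∣m∣n⇒∣m+n (S.∣ᵤ⇒∣ {+ 3} {x - ι (lookup c zero)} (3∣ zero)) (S.divides (- k) refl)))
  3∣' (suc i) = 3∣ (suc i)

positive-case : ∀ {n} (C : Code n) → SelfDual C → C (𝟏 n) → ∀ {v m} → C v → FullWeight v →
  norm (defect v) ≡ + m → 2 ∣ m → SameLattice (LS C ·ᴸ v) (LS (C ·ᶜ v))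
positive-case {n} C sd c1 {v} cv fw N≡m 2∣m =
  twisted-lattice C v fw (onesℤ n) (double (defect v)) 2δ∈B3
    (trans (⊙-identityˡ (signs v)) (signs-from-defect v fw))
  where
  2δ∈B3 : B3 C (double (defect v))
  2δ∈B3 = B3-intro C (defect v) (Mod3In-lift C (selfDual-sub C sd c1 cv)) N≡m
            (six-∣-even 2∣m (defect-norm-divisible C sd c1 cv N≡m))

shifted-defect : ∀ {n} → F3 → Vec F3 n → Vec ℤ (N.suc n)
shifted-defect a v = (ι (one₃ -₃ a) - + 3 * ι a) ∷ defect v

-- The shift adds 9 (if v₁ = 1) or 3 (if v₁ = −1) to the norm, making it ≡ 0 mod 6.
shifted-defect-norm : ∀ {n} a (v : Vec F3 n) → a ≢ zero → ∀ {m} → norm (defect (a ∷ v)) ≡ + m →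
  6 ∣ 3 N.+ m → ∃[ j ] norm (shifted-defect a v) ≡ + j × 6 ∣ j
shifted-defect-norm zero v a≢0 _ _ = ⊥-elim (a≢0 refl)
shifted-defect-norm (suc zero) v _ {m} N≡m 6∣ =
  6 N.+ (3 N.+ m) , cong (λ N → + 9 + N) (trans (sym (ZP.+-identityˡ (norm (defect v)))) N≡m) ,
  ND.∣m∣n⇒∣m+n (ND.∣-refl {6}) 6∣
shifted-defect-norm (suc (suc zero)) v _ {m} N≡m 6∣ =
  3 N.+ m , trans (split (norm (defect v))) (cong (λ N → + 3 + N) N≡m) , 6∣
  where
  split : ∀ N → + 4 + N ≡ + 3 + (+ 1 + N)
  split = solve-∀

ones-minus-e₁ : ∀ n → zipWith _-_ (onesℤ (N.suc n)) (e₁ (N.suc n)) ≡ (+ 1 - + 6) ∷ onesℤ n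
ones-minus-e₁ n = cong ((+ 1 - + 6) ∷_) (ones-minus-zeros n)
  where
  ones-minus-zeros : ∀ n → zipWith _-_ (onesℤ n) (replicate n (+ 0)) ≡ onesℤ n
  ones-minus-zeros N.zero = refl
  ones-minus-zeros (N.suc n) = cong (+ 1 ∷_) (ones-minus-zeros n)

negative-case : ∀ {n} (C : Code n) → SelfDual C → C (𝟏 n) → ∀ {v m} → C v → FullWeight v →
  prodℤ (signs v) ≡ - + 1 → norm (defect v) ≡ + m → 2 ∣ N.suc m →
  SameLattice (LS C ·ᴸ v) (LT (C ·ᶜ v))
negative-case C sd c1 {[]} cv fw () N≡m 2∣1+m
negative-case {N.suc n} C sd c1 {a ∷ v} cv fw ∏≡-1 N≡m 2∣1+m =
  twisted-lattice C (a ∷ v) fw (zipWith _-_ (onesℤ (N.suc n)) (e₁ (N.suc n)))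
    (double (shifted-defect a v)) 2δ'∈B3 twist≡
  where
  open ≡-Reasoning
  2δ'∈B3 : B3 C (double (shifted-defect a v))
  2δ'∈B3 =
    let (j , N'≡j , 6∣j) = shifted-defect-norm a v (fw zero) N≡m
                             (six-∣-odd 2∣1+m (defect-norm-divisible C sd c1 cv N≡m))
    in B3-intro C (shifted-defect a v)
         (Mod3In-shift-head C _ (defect v) (ι a) (Mod3In-lift C (selfDual-sub C sd c1 cv))) N'≡j 6∣j
  twist≡ : zipWith _-_ (onesℤ (N.suc n)) (e₁ (N.suc n)) ⊙ signs (a ∷ v)
           ≡ onesℤ (N.suc n) ⊕ double (shifted-defect a v)
  twist≡ = begin
    zipWith _-_ (onesℤ (N.suc n)) (e₁ (N.suc n)) ⊙ signs (a ∷ v)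
      ≡⟨ cong (_⊙ signs (a ∷ v)) (ones-minus-e₁ n) ⟩
    ((+ 1 - + 6) * ι a) ∷ onesℤ n ⊙ signs v
      ≡⟨ cong₂ _∷_ (sign-from-shifted-defect a (fw zero))
                   (trans (⊙-identityˡ (signs v)) (signs-from-defect v (tail-full fw))) ⟩
    onesℤ (N.suc n) ⊕ double (shifted-defect a v) ∎

proposition6p1 : (n : ℕ) (C : Code n) → SelfDual C → 12 ∣ n → C (𝟏 n)
    → (v : Vec F3 n) → C v → FullWeight v
    → (prodℤ (map ι v) ≡ + 1 → SameLattice ((LS C) ·ᴸ v) (LS (C ·ᶜ v)))
      × (prodℤ (map ι v) ≢ + 1 → SameLattice ((LS C) ·ᴸ v) (LT (C ·ᶜ v)))
proposition6p1 n C sd _ c1 v cv fw with defect-parity v fw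
... | m , N≡m , inj₁ (∏≡1 , 2∣m) =
  (λ _ → positive-case C sd c1 cv fw N≡m 2∣m) , (λ ∏≢1 → ⊥-elim (∏≢1 ∏≡1))
... | m , N≡m , inj₂ (∏≡-1 , 2∣1+m) =
  (λ ∏≡1 → ⊥-elim (-1≢1 (trans (sym ∏≡-1) ∏≡1))) , (λ _ → negative-case C sd c1 cv fw ∏≡-1 N≡m 2∣1+m)
  where
  -1≢1 : - + 1 ≢ + 1
  -1≢1 ()
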